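{- Let $G$ be a connected graph in which every vertex is contained in some triangle. Then $G$ admits no proper perfect edge dominating set.
   Context: Graphs are finite, simple and undirected. An edge dominates itself and every edge sharing an endpoint with it. A set $P\subseteq E(G)$ is a perfect edge dominating set if every edge of $E(G)\setminus P$ is dominated by exactly one edge of $P$, and an efficient edge dominating set if every edge of $E(G)$ is dominated by exactly one edge of $P$. The set $E(G)$ is the trivial perfect edge dominating set. A perfect edge dominating set is proper if it is neither the trivial one nor an efficient edge dominating set. -}

module Defs where

open import Data.Nat using (ℕ)
open import Data.Fin using (Fin)
open import Data.Bool using (Bool; true; false)
open import Data.Product using (Σ; _×_; ∃; ∃-syntax; _,_)
open import Data.Sum using (_⊎_)
open import Relation.Binary.PropositionalEquality using (_≡_)
open import Relation.Nullary using (¬_)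

record Graph (n : ℕ) : Set where
  field
    adj     : Fin n → Fin n → Bool
    adj-sym : ∀ u v → adj u v ≡ adj v u
    irrefl  : ∀ v → adj v v ≡ false
open Graph public

module _ {n : ℕ} (G : Graph n) where

  Edge : Fin n → Fin n → Set
  Edge u v = adj G u v ≡ true

  data Walk : Fin n → Fin n → Set where
    here : ∀ {v} → Walk v v
    step : ∀ {u w v} → Edge u w → Walk w v → Walk u v

  Connected : Set
  Connected = ∀ u v → Walk u v

  InTriangle : Fin n → Set
  InTriangle v = ∃[ a ] ∃[ b ] (Edge v a × Edge a b × Edge v b)

  EveryVertexInTriangle : Set
  EveryVertexInTriangle = ∀ v → InTriangle v

  record EdgeSet : Set where
    field
      mem     : Fin n → Fin n → Bool
      mem-sym : ∀ u v → mem u v ≡ mem v u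
      mem-sub : ∀ u v → mem u v ≡ true → Edge u v
  open EdgeSet public

  In : EdgeSet → Fin n → Fin n → Set
  In P u v = mem P u v ≡ true

  SameEdge : Fin n → Fin n → Fin n → Fin n → Set
  SameEdge x y u v = (x ≡ u × y ≡ v) ⊎ (x ≡ v × y ≡ u)

  Dominates : Fin n → Fin n → Fin n → Fin n → Set
  Dominates x y u v = (x ≡ u ⊎ x ≡ v) ⊎ (y ≡ u ⊎ y ≡ v)

  DominatedExactlyOnce : EdgeSet → Fin n → Fin n → Set
  DominatedExactlyOnce P u v =
    ∃[ x ] ∃[ y ] (In P x y × Dominates x y u v ×
      (∀ x' y' → In P x' y' → Dominates x' y' u v → SameEdge x' y' x y))

  IsPerfectEDS : EdgeSet → Set
  IsPerfectEDS P = ∀ u v → Edge u v → ¬ In P u v → DominatedExactlyOnce P u v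

  IsEfficientEDS : EdgeSet → Set
  IsEfficientEDS P = ∀ u v → Edge u v → DominatedExactlyOnce P u v

  IsTrivial : EdgeSet → Set
  IsTrivial P = ∀ u v → Edge u v → In P u v

  IsProperPerfectEDS : EdgeSet → Set
  IsProperPerfectEDS P = IsPerfectEDS P × ¬ IsTrivial P × ¬ IsEfficientEDS P

-- Call a vertex saturated if all its edges lie in P. A vertex with two distinct
-- P-neighbours is saturated, since an edge of E(G) \ P at it would be dominated
-- twice. Saturation spreads along edges: if v is saturated and wv is an edge,
-- an edge wc outside P would be dominated only by wv, so v is the only
-- P-neighbour of w and every other neighbour of w is uncovered by P; a triangle
-- through w then yields either an edge from v to an uncovered vertex or an edge
-- between two uncovered vertices, neither of which is possible. In a connected
-- graph a saturated vertex therefore forces P = E(G). Otherwise P is a matching,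
-- and a perfect edge dominating matching is efficient.
module Submission where

open import Defs
open import Data.Nat using (ℕ)
open import Data.Fin using (Fin; _≟_)
open import Data.Bool using (true)
import Data.Bool as Bool
open import Data.Product using (_,_)
open import Data.Sum using (_⊎_; inj₁; inj₂)
open import Data.Empty using (⊥; ⊥-elim)
open import Relation.Nullary using (¬_; Dec; yes; no)
open import Relation.Binary.PropositionalEquality using (_≡_; refl; sym; trans)

module _ {n : ℕ} (G : Graph n) where

  Edge-irrefl : ∀ {x} → ¬ Edge G x x
  Edge-irrefl {x} e with trans (sym e) (irrefl G x)
  ... | ()

  Edge-sym : ∀ {x y} → Edge G x y → Edge G y x
  Edge-sym {x} {y} e = trans (adj-sym G y x) e

  SameEdge-euclidean : ∀ {a b c d x y} →
    SameEdge G a b x y → SameEdge G c d x y → SameEdge G a b c d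
  SameEdge-euclidean (inj₁ (refl , refl)) (inj₁ (refl , refl)) = inj₁ (refl , refl)
  SameEdge-euclidean (inj₁ (refl , refl)) (inj₂ (refl , refl)) = inj₂ (refl , refl)
  SameEdge-euclidean (inj₂ (refl , refl)) (inj₁ (refl , refl)) = inj₂ (refl , refl)
  SameEdge-euclidean (inj₂ (refl , refl)) (inj₂ (refl , refl)) = inj₁ (refl , refl)

  module _ (P : EdgeSet G) where

    In? : ∀ u v → Dec (In G P u v)
    In? u v = mem P u v Bool.≟ true

    In-sym : ∀ {x y} → In G P x y → In G P y x
    In-sym {x} {y} p = trans (mem-sym P y x) p

    In-irrefl : ∀ {x} → ¬ In G P x x
    In-irrefl {x} p = Edge-irrefl (mem-sub P x x p)

    Saturated : Fin n → Set
    Saturated v = ∀ w → Edge G v w → In G P v w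

    Uncovered : Fin n → Set
    Uncovered v = ∀ w → ¬ In G P v w

    IsMatching : Set
    IsMatching = ∀ {u a b} → In G P u a → In G P u b → a ≡ b

    matching-perfect⇒efficient : IsPerfectEDS G P → IsMatching → IsEfficientEDS G P
    matching-perfect⇒efficient perfect matching u v e with In? u v
    ... | no uv∉P = perfect u v e uv∉P
    ... | yes uv∈P = u , v , uv∈P , inj₁ (inj₁ refl) , only-uv
      where
      only-uv : ∀ x y → In G P x y → Dominates G x y u v → SameEdge G x y u v
      only-uv x y p (inj₁ (inj₁ refl)) = inj₁ (refl , matching p uv∈P)
      only-uv x y p (inj₁ (inj₂ refl)) = inj₂ (refl , matching p (In-sym uv∈P))
      only-uv x y p (inj₂ (inj₁ refl)) = inj₂ (matching (In-sym p) uv∈P , refl)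
      only-uv x y p (inj₂ (inj₂ refl)) = inj₁ (matching (In-sym p) (In-sym uv∈P) , refl)

    module Perfect (perfect : IsPerfectEDS G P) where

      dominator-unique : ∀ {u v a b c d} → Edge G u v → ¬ In G P u v →
        In G P a b → Dominates G a b u v → In G P c d → Dominates G c d u v →
        SameEdge G a b c d
      dominator-unique e uv∉P ab∈P ab≻uv cd∈P cd≻uv with perfect _ _ e uv∉P
      ... | _ , _ , _ , _ , unique =
        SameEdge-euclidean (unique _ _ ab∈P ab≻uv) (unique _ _ cd∈P cd≻uv)

      ¬uncovered-edge : ∀ {a b} → Edge G a b → Uncovered a → Uncovered b → ⊥
      ¬uncovered-edge {a} {b} e ua ub with perfect a b e (ua b)
      ... | x , y , xy∈P , inj₁ (inj₁ refl) , _ = ua y xy∈P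
      ... | x , y , xy∈P , inj₁ (inj₂ refl) , _ = ub y xy∈P
      ... | x , y , xy∈P , inj₂ (inj₁ refl) , _ = ua x (In-sym xy∈P)
      ... | x , y , xy∈P , inj₂ (inj₂ refl) , _ = ub x (In-sym xy∈P)

      two-neighbours⇒saturated : ∀ {u a b} → In G P u a → In G P u b → ¬ a ≡ b →
        Saturated u
      two-neighbours⇒saturated {u} ua∈P ub∈P a≢b w e with In? u w
      ... | yes uw∈P = uw∈P
      ... | no uw∉P with dominator-unique e uw∉P ua∈P (inj₁ (inj₁ refl))
                                                ub∈P (inj₁ (inj₁ refl))
      ...   | inj₁ (_ , a≡b) = ⊥-elim (a≢b a≡b)
      ...   | inj₂ (refl , _) = ⊥-elim (In-irrefl ub∈P)

      module OutsideEdge {w c v} (wc : Edge G w c) (wc∉P : ¬ In G P w c)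
                         (wv∈P : In G P w v) where

        unique-neighbour : ∀ {a} → In G P w a → a ≡ v
        unique-neighbour {a} wa∈P with a ≟ v
        ... | yes a≡v = a≡v
        ... | no a≢v = ⊥-elim (wc∉P (two-neighbours⇒saturated wa∈P wv∈P a≢v c wc))

        other-neighbour-uncovered : Uncovered c
        other-neighbour-uncovered z cz∈P
          with dominator-unique wc wc∉P cz∈P (inj₁ (inj₂ refl)) wv∈P (inj₁ (inj₁ refl))
        ... | inj₁ (refl , _) = Edge-irrefl wc
        ... | inj₂ (refl , refl) = wc∉P wv∈P

      neighbour-of-saturated : ∀ {v} → Saturated v → ∀ {w} → Edge G v w → In G P w v
      neighbour-of-saturated sv {w} e = In-sym (sv w e)

      saturated-spreads : EveryVertexInTriangle G → ∀ {v w} → Saturated v → Edge G v w →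
        Saturated w
      saturated-spreads triangle {v} {w} sv vw c wc with In? w c
      ... | yes wc∈P = wc∈P
      ... | no wc∉P = ⊥-elim (triangle-absurd (triangle w))
        where
        wv∈P : In G P w v
        wv∈P = neighbour-of-saturated sv vw

        neighbour-cases : ∀ {x} → Edge G w x → x ≡ v ⊎ Uncovered x
        neighbour-cases {x} wx with In? w x
        ... | yes wx∈P = inj₁ (OutsideEdge.unique-neighbour wc wc∉P wv∈P wx∈P)
        ... | no wx∉P = inj₂ (OutsideEdge.other-neighbour-uncovered wx wx∉P wv∈P)

        triangle-absurd : InTriangle G w → ⊥
        triangle-absurd (a , b , wa , ab , wb) with neighbour-cases wa | neighbour-cases wb
        ... | inj₁ refl | inj₁ refl = Edge-irrefl ab
        ... | inj₁ refl | inj₂ ub   = ub v (neighbour-of-saturated sv ab)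
        ... | inj₂ ua   | inj₁ refl = ua v (neighbour-of-saturated sv (Edge-sym ab))
        ... | inj₂ ua   | inj₂ ub   = ¬uncovered-edge ab ua ub

      saturated-along-walk : EveryVertexInTriangle G → ∀ {u v} → Saturated u →
        Walk G u v → Saturated v
      saturated-along-walk triangle su here = su
      saturated-along-walk triangle su (step e walk) =
        saturated-along-walk triangle (saturated-spreads triangle su e) walk

      nontrivial⇒matching : Connected G → EveryVertexInTriangle G → ¬ IsTrivial G P →
        IsMatching
      nontrivial⇒matching connected triangle nontrivial {u} {a} {b} ua∈P ub∈P with a ≟ b
      ... | yes a≡b = a≡b
      ... | no a≢b = ⊥-elim (nontrivial λ x y e →
        saturated-along-walk triangle (two-neighbours⇒saturated ua∈P ub∈P a≢b)
                             (connected u x) y e)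

lemma6 : (n : ℕ) (G : Graph n) → Connected G → EveryVertexInTriangle G →
    (P : EdgeSet G) → ¬ IsProperPerfectEDS G P
lemma6 n G connected triangle P (perfect , nontrivial , ¬efficient) =
  ¬efficient (matching-perfect⇒efficient G P perfect
    (Perfect.nontrivial⇒matching G P perfect connected triangle nontrivial))
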